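{- Let $\mathcal{S}$ be a (possibly empty) set of substitution-closed linear structural rules. Cut elimination holds for $\mathbf{SKt}+\mathcal{S}$ (the system $\mathbf{SKt}$ extended with the rules in $\mathcal{S}$).
   Context: Formulae are in negation normal form over $a,\neg a,\lor,\land,\square,\blacksquare,\lozenge,\lozenge^{\bullet}$, where $\lozenge^{\bullet}$ is the past diamond (dual of $\blacksquare$) and $\overline A$ is the nnf of the negation of $A$. Nested sequents are multisets of formulae and structures $\circ\{\Gamma\}$, $\bullet\{\Delta\}$ with $\Gamma,\Delta$ nested sequents; $\Sigma[\,]$ denotes a context (sequent with a hole). $\mathbf{SKt}$ has the rules: $id$: $\Gamma,a,\overline a$; $cut$: from $\Gamma,A$ and $\Delta,\overline A$ infer $\Gamma,\Delta$; $\land$: from $\Gamma,A$ and $\Gamma,B$ infer $\Gamma,A\land B$; $\lor$: from $\Gamma,A,B$ infer $\Gamma,A\lor B$; $ctr$: from $\Gamma,\Delta,\Delta$ infer $\Gamma,\Delta$; $wk$: from $\Gamma$ infer $\Gamma,\Delta$; $rf$: from $\Gamma,\circ\{\Delta\}$ infer $\bullet\{\Gamma\},\Delta$; $rp$: from $\Gamma,\bullet\{\Delta\}$ infer $\circ\{\Gamma\},\Delta$; $\blacksquare$: from $\Gamma,\bullet\{A\}$ infer $\Gamma,\blacksquare A$; $\square$: from $\Gamma,\circ\{A\}$ infer $\Gamma,\square A$; $\lozenge^{\bullet}$: from $\Gamma,\bullet\{\Delta,A\}$ infer $\Gamma,\bullet\{\Delta\},\lozenge^{\bullet}A$; $\lozenge$: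 from $\Gamma,\circ\{\Delta,A\}$ infer $\Gamma,\circ\{\Delta\},\lozenge A$. A structural rule (one premise) is linear if in every instance the multiset of formula occurrences of the premise equals that of the conclusion, with an induced bijection between occurrences (rules given by finite schemata without side conditions). It is substitution-closed if, whenever $\Sigma'[A]/\Sigma[A]$ is an instance with $A$ an occurrence shared between premise and conclusion, then $\Sigma'[\Delta]/\Sigma[\Delta]$ is also an instance for any structure $\Delta$. -}

module Defs where

open import Data.Nat using (ℕ)
open import Data.Bool using (Bool; true; false; T)
open import Data.List using (List; []; _∷_; _++_)
open import Data.Product using (Σ; _×_)
open import Relation.Binary.PropositionalEquality using (_≡_)
open import Function.Bundles using (_↔_; Inverse)

-- Formulae in negation normal form (atoms are indexed by ℕ)

data Fm : Set where
  at   : ℕ → Fm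
  nat  : ℕ → Fm          -- ¬ a
  _∨_  : Fm → Fm → Fm
  _∧_  : Fm → Fm → Fm
  □    : Fm → Fm         -- future box
  ■    : Fm → Fm         -- past box
  ◇    : Fm → Fm         -- future diamond
  ◆    : Fm → Fm         -- past diamond (dual of ■)

neg : Fm → Fm
neg (at a)  = nat a
neg (nat a) = at a
neg (A ∨ B) = neg A ∧ neg B
neg (A ∧ B) = neg A ∨ neg B
neg (□ A)   = ◇ (neg A)
neg (■ A)   = ◆ (neg A)
neg (◇ A)   = □ (neg A)
neg (◆ A)   = ■ (neg A)

-- Nested sequents: lists of items, read as multisets (see _≈_ below)

data Item : Set where
  fm : Fm → Item
  wh : List Item → Item   -- ∘{Γ}
  bl : List Item → Item   -- •{Γ}

Seq : Set
Seq = List Item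

mutual
  data _≈ᵢ_ : Item → Item → Set where
    fm : ∀ {A} → fm A ≈ᵢ fm A
    wh : ∀ {Γ Δ} → Γ ≈ Δ → wh Γ ≈ᵢ wh Δ
    bl : ∀ {Γ Δ} → Γ ≈ Δ → bl Γ ≈ᵢ bl Δ

  data _≈_ : Seq → Seq → Set where
    []    : [] ≈ []
    _∷_   : ∀ {x y Γ Δ} → x ≈ᵢ y → Γ ≈ Δ → (x ∷ Γ) ≈ (y ∷ Δ)
    swap  : ∀ {x y Γ} → (x ∷ y ∷ Γ) ≈ (y ∷ x ∷ Γ)
    trans : ∀ {Γ Δ Θ} → Γ ≈ Δ → Δ ≈ Θ → Γ ≈ Θ

-- Formula occurrences and contexts Σ[ ] (a hole at a formula occurrence)

data Pos : Seq → Set where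
  here : ∀ {A Γ} → Pos (fm A ∷ Γ)
  there : ∀ {x Γ} → Pos Γ → Pos (x ∷ Γ)
  inWh : ∀ {Δ Γ} → Pos Δ → Pos (wh Δ ∷ Γ)
  inBl : ∀ {Δ Γ} → Pos Δ → Pos (bl Δ ∷ Γ)

fmAt : ∀ {Γ} → Pos Γ → Fm
fmAt (here {A}) = A
fmAt (there p)  = fmAt p
fmAt (inWh p)   = fmAt p
fmAt (inBl p)   = fmAt p

-- plug Γ p Δ : writing Γ = Σ[A] with A the occurrence p, this is Σ[Δ]
plug : (Γ : Seq) → Pos Γ → Seq → Seq
plug (fm _ ∷ Γ) here        Θ = Θ ++ Γ
plug (x ∷ Γ)    (there p)   Θ = x ∷ plug Γ p Θ
plug (wh Δ ∷ Γ) (inWh p)    Θ = wh (plug Δ p Θ) ∷ Γ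
plug (bl Δ ∷ Γ) (inBl p)    Θ = bl (plug Δ p Θ) ∷ Γ

-- Linear structural rules (one premise): every instance comes with a
-- bijection between the formula occurrences of premise and conclusion
-- preserving the formulae.

record LinearRule : Set₁ where
  field
    Inst : Seq → Seq → Set          -- Inst P C : premise P / conclusion C
    occ  : ∀ {P C} → Inst P C → Pos P ↔ Pos C
    occ-fm : ∀ {P C} (i : Inst P C) (p : Pos P) →
             fmAt (Inverse.to (occ i) p) ≡ fmAt p

-- substitution-closed: if Σ'[A]/Σ[A] is an instance with A a shared
-- occurrence, then Σ'[Δ]/Σ[Δ] is an instance for every structure Δ
SubstClosed : LinearRule → Set
SubstClosed R = ∀ {P C} (i : Inst P C) (p : Pos P) (Δ : Seq) →
                Inst (plug P p Δ) (plug C (Inverse.to (occ i) p) Δ)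
  where open LinearRule R

record RuleSet : Set₁ where
  field
    Idx  : Set
    rule : Idx → LinearRule

-- Derivability in SKt + S.  The flag c says whether cut is available.

[_] : Item → Seq
[ x ] = x ∷ []

data Der (c : Bool) (S : RuleSet) : Seq → Set where
  id   : ∀ Γ a → Der c S (Γ ++ fm (at a) ∷ fm (nat a) ∷ [])
  cut  : T c → ∀ Γ Δ A → Der c S (Γ ++ [ fm A ]) → Der c S (Δ ++ [ fm (neg A) ]) →
         Der c S (Γ ++ Δ)
  and  : ∀ Γ A B → Der c S (Γ ++ [ fm A ]) → Der c S (Γ ++ [ fm B ]) →
         Der c S (Γ ++ [ fm (A ∧ B) ])
  or   : ∀ Γ A B → Der c S (Γ ++ fm A ∷ fm B ∷ []) → Der c S (Γ ++ [ fm (A ∨ B) ])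
  ctr  : ∀ Γ Δ → Der c S (Γ ++ Δ ++ Δ) → Der c S (Γ ++ Δ)
  wk   : ∀ Γ Δ → Der c S Γ → Der c S (Γ ++ Δ)
  rf   : ∀ Γ Δ → Der c S (Γ ++ [ wh Δ ]) → Der c S (bl Γ ∷ Δ)
  rp   : ∀ Γ Δ → Der c S (Γ ++ [ bl Δ ]) → Der c S (wh Γ ∷ Δ)
  boxP : ∀ Γ A → Der c S (Γ ++ [ bl [ fm A ] ]) → Der c S (Γ ++ [ fm (■ A) ])
  boxF : ∀ Γ A → Der c S (Γ ++ [ wh [ fm A ] ]) → Der c S (Γ ++ [ fm (□ A) ])
  diaP : ∀ Γ Δ A → Der c S (Γ ++ [ bl (Δ ++ [ fm A ]) ]) →
         Der c S (Γ ++ bl Δ ∷ fm (◆ A) ∷ [])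
  diaF : ∀ Γ Δ A → Der c S (Γ ++ [ wh (Δ ++ [ fm A ]) ]) →
         Der c S (Γ ++ wh Δ ∷ fm (◇ A) ∷ [])
  exch : ∀ {Γ Δ} → Γ ≈ Δ → Der c S Γ → Der c S Δ
  str  : ∀ (i : RuleSet.Idx S) {P C} → LinearRule.Inst (RuleSet.rule S i) P C →
         Der c S P → Der c S C

CutElimination : RuleSet → Set
CutElimination S = ∀ Γ → Der true S Γ → Der false S Γ

-- Cut on A between Γ, A and Δ, Ā is eliminated by replacing every ancestor of Ā in the cut-free
-- derivation of Δ, Ā by Γ. Where an ancestor is principal, its introduction is replaced by
-- applying the same procedure to the derivation of Γ, A, now with the roles of A and Ā swapped;
-- this leaves cuts on immediate subformulae only, so the argument is an induction on A.
-- A linear structural rule commutes with the replacement because substitution closure moves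
-- one occurrence at a time: the ancestors are first marked by a fresh atom, which makes their
-- preimages under the rule instance identifiable, and only then is the atom replaced by Γ.
module Submission where

open import Defs
open import Data.Bool using (Bool; true; false; if_then_else_)
open import Data.Bool.Properties using (T-≡)
open import Data.Nat using (ℕ; zero; suc; _+_; _≤_; s≤s; _≡ᵇ_; _≟_)
open import Data.Nat.Properties
  using (≡ᵇ⇒≡; ≡⇒≡ᵇ; +-assoc; +-suc; suc-injective; 0≢1+n; ≤-refl;
         m+n≡0⇒m≡0; m+n≡0⇒n≡0; m+n≤o⇒m≤o; m+n≤o⇒n≤o)
open import Data.List using (List; []; _∷_; _++_)
open import Data.List.Properties using (++-assoc; ++-identityʳ)
open import Data.Product using (_,_; _×_; Σ; ∃; ∃₂)
open import Data.Empty using (⊥-elim)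
open import Function.Bundles using (Inverse; Equivalence)
open import Relation.Nullary using (yes; no)
open import Relation.Binary.PropositionalEquality
  using (_≡_; _≢_; refl; sym; cong; cong₂; subst; subst₂) renaming (trans to ≡-trans)

mutual
  ≈ᵢ-refl : ∀ x → x ≈ᵢ x
  ≈ᵢ-refl (fm A) = fm
  ≈ᵢ-refl (wh Γ) = wh (≈-refl Γ)
  ≈ᵢ-refl (bl Γ) = bl (≈-refl Γ)

  ≈-refl : ∀ Γ → Γ ≈ Γ
  ≈-refl []      = []
  ≈-refl (x ∷ Γ) = ≈ᵢ-refl x ∷ ≈-refl Γ

mutual
  ≈ᵢ-sym : ∀ {x y} → x ≈ᵢ y → y ≈ᵢ x
  ≈ᵢ-sym fm     = fm
  ≈ᵢ-sym (wh p) = wh (≈-sym p)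
  ≈ᵢ-sym (bl p) = bl (≈-sym p)

  ≈-sym : ∀ {Γ Δ} → Γ ≈ Δ → Δ ≈ Γ
  ≈-sym []          = []
  ≈-sym (x ∷ p)     = ≈ᵢ-sym x ∷ ≈-sym p
  ≈-sym swap        = swap
  ≈-sym (trans p q) = trans (≈-sym q) (≈-sym p)

≡⇒≈ : ∀ {Γ Δ} → Γ ≡ Δ → Γ ≈ Δ
≡⇒≈ {Γ} refl = ≈-refl Γ

++⁺ˡ : ∀ Γ {Δ Δ'} → Δ ≈ Δ' → (Γ ++ Δ) ≈ (Γ ++ Δ')
++⁺ˡ []      q = q
++⁺ˡ (x ∷ Γ) q = ≈ᵢ-refl x ∷ ++⁺ˡ Γ q

++⁺ : ∀ {Γ Γ' Δ Δ'} → Γ ≈ Γ' → Δ ≈ Δ' → (Γ ++ Δ) ≈ (Γ' ++ Δ')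
++⁺ []                q = q
++⁺ (x ∷ p)           q = x ∷ ++⁺ p q
++⁺ {x ∷ y ∷ Γ} swap  q = trans swap (≈ᵢ-refl y ∷ (≈ᵢ-refl x ∷ ++⁺ˡ Γ q))
++⁺ {Δ = Δ} (trans p p') q = trans (++⁺ p (≈-refl Δ)) (++⁺ p' q)

++⁺ʳ : ∀ {Γ Γ'} Δ → Γ ≈ Γ' → (Γ ++ Δ) ≈ (Γ' ++ Δ)
++⁺ʳ Δ p = ++⁺ p (≈-refl Δ)

shift : ∀ x Γ Δ → (x ∷ Γ ++ Δ) ≈ (Γ ++ x ∷ Δ)
shift x []      Δ = ≈-refl _
shift x (y ∷ Γ) Δ = trans swap (≈ᵢ-refl y ∷ shift x Γ Δ)

++-comm : ∀ Γ Δ → (Γ ++ Δ) ≈ (Δ ++ Γ)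
++-comm []      Δ = ≡⇒≈ (sym (++-identityʳ Δ))
++-comm (x ∷ Γ) Δ = trans (≈ᵢ-refl x ∷ ++-comm Γ Δ) (shift x Δ Γ)

++-assoc-≈ : ∀ Γ Δ Θ → ((Γ ++ Δ) ++ Θ) ≈ (Γ ++ Δ ++ Θ)
++-assoc-≈ Γ Δ Θ = ≡⇒≈ (++-assoc Γ Δ Θ)

++-swapˡ : ∀ Γ Δ Θ → (Γ ++ Δ ++ Θ) ≈ (Δ ++ Γ ++ Θ)
++-swapˡ Γ Δ Θ = trans (≈-sym (++-assoc-≈ Γ Δ Θ))
                   (trans (++⁺ʳ Θ (++-comm Γ Δ)) (++-assoc-≈ Δ Γ Θ))

module _ {c : Bool} {S : RuleSet} where

  bl-wk : ∀ X R W → Der c S (bl X ∷ R) → Der c S (bl (X ++ W) ∷ R)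
  bl-wk X R W d = rf (X ++ W) R (exch (++-comm [ wh R ] (X ++ W))
                    (wk (wh R ∷ X) W (rp R X (exch (++-comm [ bl X ] R) d))))

  wh-wk : ∀ X R W → Der c S (wh X ∷ R) → Der c S (wh (X ++ W) ∷ R)
  wh-wk X R W d = rp (X ++ W) R (exch (++-comm [ bl R ] (X ++ W))
                    (wk (bl R ∷ X) W (rf R X (exch (++-comm [ wh X ] R) d))))

  ctr-head : ∀ x R → Der c S (x ∷ x ∷ R) → Der c S (x ∷ R)
  ctr-head x R d = exch (++-comm R [ x ]) (ctr R [ x ] (exch (++-comm (x ∷ [ x ]) R) d))

  bl-merge : ∀ X Y R → Der c S (bl X ∷ bl Y ∷ R) → Der c S (bl (X ++ Y) ∷ R)
  bl-merge X Y R d = ctr-head _ R (exch (bl (++-comm Y X) ∷ ≈-refl _)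
      (bl-wk Y (bl (X ++ Y) ∷ R) X (exch swap (bl-wk X (bl Y ∷ R) Y d))))

  wh-merge : ∀ X Y R → Der c S (wh X ∷ wh Y ∷ R) → Der c S (wh (X ++ Y) ∷ R)
  wh-merge X Y R d = ctr-head _ R (exch (wh (++-comm Y X) ∷ ≈-refl _)
      (wh-wk Y (wh (X ++ Y) ∷ R) X (exch swap (wh-wk X (wh Y ∷ R) Y d))))

-- A template is a nested sequent with holes; holes mark the ancestors of the cut formula.
data TItem : Set where
  hole : TItem
  tfm  : Fm → TItem
  twh  : List TItem → TItem
  tbl  : List TItem → TItem

Template : Set
Template = List TItem

infix 25 _⟦_⟧ _⟦_⟧ᵢ _⟨_⟩ _⟨_⟩ᵢ

mutual
  _⟦_⟧ᵢ : TItem → Seq → Seq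
  hole  ⟦ Θ ⟧ᵢ = Θ
  tfm A ⟦ Θ ⟧ᵢ = [ fm A ]
  twh Π ⟦ Θ ⟧ᵢ = [ wh (Π ⟦ Θ ⟧) ]
  tbl Π ⟦ Θ ⟧ᵢ = [ bl (Π ⟦ Θ ⟧) ]

  _⟦_⟧ : Template → Seq → Seq
  []      ⟦ Θ ⟧ = []
  (y ∷ Π) ⟦ Θ ⟧ = y ⟦ Θ ⟧ᵢ ++ Π ⟦ Θ ⟧

⟦⟧-++ : ∀ Π Π' Θ → (Π ++ Π') ⟦ Θ ⟧ ≡ Π ⟦ Θ ⟧ ++ Π' ⟦ Θ ⟧
⟦⟧-++ []      Π' Θ = refl
⟦⟧-++ (y ∷ Π) Π' Θ = ≡-trans (cong (y ⟦ Θ ⟧ᵢ ++_) (⟦⟧-++ Π Π' Θ))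
                             (sym (++-assoc (y ⟦ Θ ⟧ᵢ) (Π ⟦ Θ ⟧) (Π' ⟦ Θ ⟧)))

⟦⟧-∷ʳ : ∀ Π y Θ → (Π ++ y ∷ []) ⟦ Θ ⟧ ≡ Π ⟦ Θ ⟧ ++ y ⟦ Θ ⟧ᵢ
⟦⟧-∷ʳ Π y Θ = ≡-trans (⟦⟧-++ Π (y ∷ []) Θ) (cong (Π ⟦ Θ ⟧ ++_) (++-identityʳ _))


mutual
  rigidᵢ : Item → TItem
  rigidᵢ (fm A) = tfm A
  rigidᵢ (wh Γ) = twh (rigid Γ)
  rigidᵢ (bl Γ) = tbl (rigid Γ)

  rigid : Seq → Template
  rigid []      = []
  rigid (x ∷ Γ) = rigidᵢ x ∷ rigid Γ

mutual
  rigidᵢ-⟦⟧ : ∀ x Θ → rigidᵢ x ⟦ Θ ⟧ᵢ ≡ [ x ]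
  rigidᵢ-⟦⟧ (fm A) Θ = refl
  rigidᵢ-⟦⟧ (wh Γ) Θ = cong (λ Γ' → [ wh Γ' ]) (rigid-⟦⟧ Γ Θ)
  rigidᵢ-⟦⟧ (bl Γ) Θ = cong (λ Γ' → [ bl Γ' ]) (rigid-⟦⟧ Γ Θ)

  rigid-⟦⟧ : ∀ X Θ → rigid X ⟦ Θ ⟧ ≡ X
  rigid-⟦⟧ []      Θ = refl
  rigid-⟦⟧ (x ∷ X) Θ = cong₂ _++_ (rigidᵢ-⟦⟧ x Θ) (rigid-⟦⟧ X Θ)

mutual
  holesᵢ : TItem → ℕ
  holesᵢ hole    = 1
  holesᵢ (tfm A) = 0
  holesᵢ (twh Π) = holes Π
  holesᵢ (tbl Π) = holes Π

  holes : Template → ℕ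
  holes []      = 0
  holes (y ∷ Π) = holesᵢ y + holes Π

mutual
  holesᵢ≡0⇒⟦⟧-const : ∀ y → holesᵢ y ≡ 0 → ∀ Θ Θ' → y ⟦ Θ ⟧ᵢ ≡ y ⟦ Θ' ⟧ᵢ
  holesᵢ≡0⇒⟦⟧-const (tfm A) h Θ Θ' = refl
  holesᵢ≡0⇒⟦⟧-const (twh Π) h Θ Θ' = cong (λ Γ → [ wh Γ ]) (holes≡0⇒⟦⟧-const Π h Θ Θ')
  holesᵢ≡0⇒⟦⟧-const (tbl Π) h Θ Θ' = cong (λ Γ → [ bl Γ ]) (holes≡0⇒⟦⟧-const Π h Θ Θ')

  holes≡0⇒⟦⟧-const : ∀ Π → holes Π ≡ 0 → ∀ Θ Θ' → Π ⟦ Θ ⟧ ≡ Π ⟦ Θ' ⟧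
  holes≡0⇒⟦⟧-const []      h Θ Θ' = refl
  holes≡0⇒⟦⟧-const (y ∷ Π) h Θ Θ' =
    cong₂ _++_ (holesᵢ≡0⇒⟦⟧-const y (m+n≡0⇒m≡0 (holesᵢ y) h) Θ Θ')
               (holes≡0⇒⟦⟧-const Π (m+n≡0⇒n≡0 (holesᵢ y) h) Θ Θ')

_⟨_⟩ : Template → Fm → Seq
Π ⟨ F ⟩ = Π ⟦ [ fm F ] ⟧

_⟨_⟩ᵢ : TItem → Fm → Item
hole  ⟨ F ⟩ᵢ = fm F
tfm A ⟨ F ⟩ᵢ = fm A
twh Π ⟨ F ⟩ᵢ = wh (Π ⟨ F ⟩)
tbl Π ⟨ F ⟩ᵢ = bl (Π ⟨ F ⟩)

module _ {F : Fm} where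

  ⟨⟩-∷ : ∀ y Π → (y ∷ Π) ⟨ F ⟩ ≡ y ⟨ F ⟩ᵢ ∷ Π ⟨ F ⟩
  ⟨⟩-∷ hole    Π = refl
  ⟨⟩-∷ (tfm A) Π = refl
  ⟨⟩-∷ (twh N) Π = refl
  ⟨⟩-∷ (tbl N) Π = refl

  ⟨⟩-[]⁻¹ : ∀ Π → Π ⟨ F ⟩ ≡ [] → Π ≡ []
  ⟨⟩-[]⁻¹ []            e = refl
  ⟨⟩-[]⁻¹ (hole ∷ Π)    ()
  ⟨⟩-[]⁻¹ (tfm A ∷ Π)   ()
  ⟨⟩-[]⁻¹ (twh N ∷ Π)   ()
  ⟨⟩-[]⁻¹ (tbl N ∷ Π)   ()

  ⟨⟩-∷⁻¹ : ∀ Π {x X} → Π ⟨ F ⟩ ≡ x ∷ X →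
           ∃₂ λ y M → Π ≡ y ∷ M × y ⟨ F ⟩ᵢ ≡ x × M ⟨ F ⟩ ≡ X
  ⟨⟩-∷⁻¹ (hole ∷ M)  refl = hole , M , refl , refl , refl
  ⟨⟩-∷⁻¹ (tfm A ∷ M) refl = tfm A , M , refl , refl , refl
  ⟨⟩-∷⁻¹ (twh N ∷ M) refl = twh N , M , refl , refl , refl
  ⟨⟩-∷⁻¹ (tbl N ∷ M) refl = tbl N , M , refl , refl , refl

  ⟨⟩-++⁻¹ : ∀ Γ {Δ} Π → Π ⟨ F ⟩ ≡ Γ ++ Δ →
            ∃₂ λ Π₁ Π₂ → Π ≡ Π₁ ++ Π₂ × Π₁ ⟨ F ⟩ ≡ Γ × Π₂ ⟨ F ⟩ ≡ Δ
  ⟨⟩-++⁻¹ []      Π e = [] , Π , refl , refl , e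
  ⟨⟩-++⁻¹ (x ∷ Γ) Π e with ⟨⟩-∷⁻¹ Π e
  ... | y , M , refl , refl , e' with ⟨⟩-++⁻¹ Γ M e'
  ... | Π₁ , Π₂ , refl , refl , refl = y ∷ Π₁ , Π₂ , refl , ⟨⟩-∷ y Π₁ , refl

  ⟨⟩-∷ʳ⁻¹ : ∀ Γ {x} Π → Π ⟨ F ⟩ ≡ Γ ++ [ x ] →
            ∃₂ λ Π₁ y → Π ≡ Π₁ ++ y ∷ [] × Π₁ ⟨ F ⟩ ≡ Γ × y ⟨ F ⟩ᵢ ≡ x
  ⟨⟩-∷ʳ⁻¹ Γ Π e with ⟨⟩-++⁻¹ Γ Π e
  ... | Π₁ , Π₂ , refl , e₁ , e₂ with ⟨⟩-∷⁻¹ Π₂ e₂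
  ... | y , M , refl , eₓ , e₃ with ⟨⟩-[]⁻¹ M e₃
  ... | refl = Π₁ , y , refl , e₁ , eₓ

  module _ (Θ : Seq) where
    mutual
      ≈ᵢ-lift : ∀ {x x'} → x ≈ᵢ x' → ∀ y → y ⟨ F ⟩ᵢ ≡ x →
                ∃ λ y' → y' ⟨ F ⟩ᵢ ≡ x' × y ⟦ Θ ⟧ᵢ ≈ y' ⟦ Θ ⟧ᵢ
      ≈ᵢ-lift fm     y       e    = y , e , ≈-refl _
      ≈ᵢ-lift (wh p) (twh N) refl with ≈-lift p N refl
      ... | N' , e , q = twh N' , cong wh e , wh q ∷ []
      ≈ᵢ-lift (bl p) (tbl N) refl with ≈-lift p N refl
      ... | N' , e , q = tbl N' , cong bl e , bl q ∷ []

      ≈-lift : ∀ {Γ Δ} → Γ ≈ Δ → ∀ Π → Π ⟨ F ⟩ ≡ Γ →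
               ∃ λ Π' → Π' ⟨ F ⟩ ≡ Δ × Π ⟦ Θ ⟧ ≈ Π' ⟦ Θ ⟧
      ≈-lift [] Π e with ⟨⟩-[]⁻¹ Π e
      ... | refl = [] , refl , []
      ≈-lift (p ∷ ps) Π e with ⟨⟩-∷⁻¹ Π e
      ... | y , M , refl , e₁ , e₂ with ≈ᵢ-lift p y e₁ | ≈-lift ps M e₂
      ... | y' , e₁' , q₁ | M' , e₂' , q₂ =
        y' ∷ M' , ≡-trans (⟨⟩-∷ y' M') (cong₂ _∷_ e₁' e₂') , ++⁺ q₁ q₂
      ≈-lift swap Π e with ⟨⟩-∷⁻¹ Π e
      ... | y₁ , M , refl , e₁ , e₂ with ⟨⟩-∷⁻¹ M e₂
      ... | y₂ , M₂ , refl , e₃ , e₄ =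
        y₂ ∷ y₁ ∷ M₂ ,
        ≡-trans (⟨⟩-∷ y₂ (y₁ ∷ M₂)) (cong₂ _∷_ e₃ (≡-trans (⟨⟩-∷ y₁ M₂) (cong₂ _∷_ e₁ e₄))) ,
        ++-swapˡ (y₁ ⟦ Θ ⟧ᵢ) (y₂ ⟦ Θ ⟧ᵢ) (M₂ ⟦ Θ ⟧)
      ≈-lift (trans p q) Π e with ≈-lift p Π e
      ... | Π₁ , e₁ , q₁ with ≈-lift q Π₁ e₁
      ... | Π₂ , e₂ , q₂ = Π₂ , e₂ , trans q₁ q₂

plug-there : ∀ x Γ (p : Pos Γ) Θ → plug (x ∷ Γ) (there p) Θ ≡ x ∷ plug Γ p Θ
plug-there (fm A) Γ p Θ = refl
plug-there (wh Δ) Γ p Θ = refl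
plug-there (bl Δ) Γ p Θ = refl

module Atom (f : ℕ) where

  isAt : Fm → Bool
  isAt (at n) = n ≡ᵇ f
  isAt _      = false

  isAt-sound : ∀ A → isAt A ≡ true → A ≡ at f
  isAt-sound (at n) e = cong at (≡ᵇ⇒≡ n f (Equivalence.from T-≡ e))

  isAt-at : isAt (at f) ≡ true
  isAt-at = Equivalence.to T-≡ (≡⇒≡ᵇ f f refl)

  mutual
    countᵢ : Item → ℕ
    countᵢ (fm A) = if isAt A then 1 else 0
    countᵢ (wh Γ) = count Γ
    countᵢ (bl Γ) = count Γ

    count : Seq → ℕ
    count []      = 0
    count (x ∷ Γ) = countᵢ x + count Γ

  count-++ : ∀ X Y → count (X ++ Y) ≡ count X + count Y
  count-++ []      Y = refl
  count-++ (x ∷ X) Y = ≡-trans (cong (countᵢ x +_) (count-++ X Y))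
                               (sym (+-assoc (countᵢ x) (count X) (count Y)))

  count-++⁻¹ : ∀ X Y → count (X ++ Y) ≡ 0 → count X ≡ 0 × count Y ≡ 0
  count-++⁻¹ X Y e = let e' = ≡-trans (sym (count-++ X Y)) e in m+n≡0⇒m≡0 _ e' , m+n≡0⇒n≡0 _ e'

  count≢0⇒occurs : ∀ X → count X ≢ 0 → Σ (Pos X) λ q → fmAt q ≡ at f
  count≢0⇒occurs []           h = ⊥-elim (h refl)
  count≢0⇒occurs (fm A ∷ Γ)   h with isAt A in e
  ... | true  = here , isAt-sound A e
  ... | false with count≢0⇒occurs Γ h
  ...   | q , eq = there q , eq
  count≢0⇒occurs (wh Δ ∷ Γ) h with count Δ ≟ 0
  ... | no nz with count≢0⇒occurs Δ nz
  ...   | q , eq = inWh q , eq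
  count≢0⇒occurs (wh Δ ∷ Γ) h | yes z with count≢0⇒occurs Γ (λ e → h (≡-trans (cong (_+ count Γ) z) e))
  ...   | q , eq = there q , eq
  count≢0⇒occurs (bl Δ ∷ Γ) h with count Δ ≟ 0
  ... | no nz with count≢0⇒occurs Δ nz
  ...   | q , eq = inBl q , eq
  count≢0⇒occurs (bl Δ ∷ Γ) h | yes z with count≢0⇒occurs Γ (λ e → h (≡-trans (cong (_+ count Γ) z) e))
  ...   | q , eq = there q , eq

  occurs⇒count≢0 : ∀ X (q : Pos X) → fmAt q ≡ at f → count X ≢ 0
  occurs⇒count≢0 (fm _ ∷ Γ) here refl e rewrite isAt-at with e
  ... | ()
  occurs⇒count≢0 (x ∷ Γ)    (there q) eq e = occurs⇒count≢0 Γ q eq (m+n≡0⇒n≡0 (countᵢ x) e)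
  occurs⇒count≢0 (wh Δ ∷ Γ) (inWh q)  eq e = occurs⇒count≢0 Δ q eq (m+n≡0⇒m≡0 (count Δ) e)
  occurs⇒count≢0 (bl Δ ∷ Γ) (inBl q)  eq e = occurs⇒count≢0 Δ q eq (m+n≡0⇒m≡0 (count Δ) e)

  count≡0⇒≢ : ∀ F → count [ fm F ] ≡ 0 → at f ≢ F
  count≡0⇒≢ F e refl = occurs⇒count≢0 [ fm F ] here refl e

  module _ (Θ : Seq) where
    mutual
      replaceᵢ : Item → Seq
      replaceᵢ (fm A) = if isAt A then Θ else [ fm A ]
      replaceᵢ (wh Γ) = [ wh (replace Γ) ]
      replaceᵢ (bl Γ) = [ bl (replace Γ) ]

      replace : Seq → Seq
      replace []      = []
      replace (x ∷ Γ) = replaceᵢ x ++ replace Γ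

    replace-++ : ∀ X Y → replace (X ++ Y) ≡ replace X ++ replace Y
    replace-++ []      Y = refl
    replace-++ (x ∷ X) Y = ≡-trans (cong (replaceᵢ x ++_) (replace-++ X Y))
                                   (sym (++-assoc (replaceᵢ x) (replace X) (replace Y)))

    mutual
      countᵢ≡0⇒replaceᵢ≡[-] : ∀ x → countᵢ x ≡ 0 → replaceᵢ x ≡ [ x ]
      countᵢ≡0⇒replaceᵢ≡[-] (fm A) e with isAt A
      ... | false = refl
      countᵢ≡0⇒replaceᵢ≡[-] (wh Γ) e = cong (λ Γ' → [ wh Γ' ]) (count≡0⇒replace≡id Γ e)
      countᵢ≡0⇒replaceᵢ≡[-] (bl Γ) e = cong (λ Γ' → [ bl Γ' ]) (count≡0⇒replace≡id Γ e)

      count≡0⇒replace≡id : ∀ X → count X ≡ 0 → replace X ≡ X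
      count≡0⇒replace≡id []      e = refl
      count≡0⇒replace≡id (x ∷ X) e =
        cong₂ _++_ (countᵢ≡0⇒replaceᵢ≡[-] x (m+n≡0⇒m≡0 (countᵢ x) e))
                   (count≡0⇒replace≡id X (m+n≡0⇒n≡0 (countᵢ x) e))

    module _ (F : Fm) where
      mutual
        replace-⟨at⟩ᵢ : ∀ y → count (y ⟦ [ fm F ] ⟧ᵢ) ≡ 0 → replace (y ⟦ [ fm (at f) ] ⟧ᵢ) ≡ y ⟦ Θ ⟧ᵢ
        replace-⟨at⟩ᵢ hole    e rewrite isAt-at = ++-identityʳ Θ
        replace-⟨at⟩ᵢ (tfm A) e with isAt A
        ... | false = refl
        replace-⟨at⟩ᵢ (twh N) e = cong (λ Γ → [ wh Γ ]) (replace-⟨at⟩ N (m+n≡0⇒m≡0 _ e))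
        replace-⟨at⟩ᵢ (tbl N) e = cong (λ Γ → [ bl Γ ]) (replace-⟨at⟩ N (m+n≡0⇒m≡0 _ e))

        replace-⟨at⟩ : ∀ M → count (M ⟨ F ⟩) ≡ 0 → replace (M ⟨ at f ⟩) ≡ M ⟦ Θ ⟧
        replace-⟨at⟩ []      e = refl
        replace-⟨at⟩ (y ∷ M) e =
          let e₁ , e₂ = count-++⁻¹ (y ⟦ [ fm F ] ⟧ᵢ) (M ⟨ F ⟩) e
          in ≡-trans (replace-++ (y ⟦ [ fm (at f) ] ⟧ᵢ) (M ⟨ at f ⟩))
                     (cong₂ _++_ (replace-⟨at⟩ᵢ y e₁) (replace-⟨at⟩ M e₂))

    module _ (fresh : count Θ ≡ 0) where

      count-plug : ∀ X (p : Pos X) → fmAt p ≡ at f → suc (count (plug X p Θ)) ≡ count X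
      count-plug (fm _ ∷ Γ) here refl rewrite isAt-at | count-++ Θ Γ | fresh = refl
      count-plug (x ∷ Γ) (there p) e rewrite plug-there x Γ p Θ =
        ≡-trans (sym (+-suc (countᵢ x) (count (plug Γ p Θ)))) (cong (countᵢ x +_) (count-plug Γ p e))
      count-plug (wh Δ ∷ Γ) (inWh p) e = cong (_+ count Γ) (count-plug Δ p e)
      count-plug (bl Δ ∷ Γ) (inBl p) e = cong (_+ count Γ) (count-plug Δ p e)

      replace-plug : ∀ X (p : Pos X) → fmAt p ≡ at f → replace (plug X p Θ) ≡ replace X
      replace-plug (fm _ ∷ Γ) here refl
        rewrite isAt-at | replace-++ Θ Γ | count≡0⇒replace≡id Θ fresh = refl
      replace-plug (x ∷ Γ) (there p) e rewrite plug-there x Γ p Θ =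
        cong (replaceᵢ x ++_) (replace-plug Γ p e)
      replace-plug (wh Δ ∷ Γ) (inWh p) e = cong (λ Δ' → wh Δ' ∷ replace Γ) (replace-plug Δ p e)
      replace-plug (bl Δ ∷ Γ) (inBl p) e = cong (λ Δ' → bl Δ' ∷ replace Γ) (replace-plug Δ p e)

      -- Induction on the number of occurrences in the conclusion, which drops by one with each
      -- application of substitution closure since Θ does not contain the atom.
      Inst-replace : (R : LinearRule) → SubstClosed R → ∀ {P C} →
                     LinearRule.Inst R P C → LinearRule.Inst R (replace P) (replace C)
      Inst-replace R sc {C = C} inst = go (count C) refl inst
        where
          open LinearRule R

          go : ∀ n {P C} → count C ≡ n → Inst P C → Inst (replace P) (replace C)
          go zero {P} {C} e i with count P ≟ 0
          ... | yes eP = subst₂ Inst (sym (count≡0⇒replace≡id P eP)) (sym (count≡0⇒replace≡id C e)) i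
          ... | no nP with count≢0⇒occurs P nP
          ...   | q , fq = ⊥-elim (occurs⇒count≢0 C (Inverse.to (occ i) q) (≡-trans (occ-fm i q) fq) e)
          go (suc n) {P} {C} e i with count≢0⇒occurs C (λ z → 0≢1+n (≡-trans (sym z) e))
          ... | q , fq = subst₂ Inst (replace-plug P p fp) (replace-plug C q fq)
                           (go n (suc-injective (≡-trans (count-plug C q fq) e)) i')
            where
              p = Inverse.from (occ i) q
              to-p : Inverse.to (occ i) p ≡ q
              to-p = Inverse.strictlyInverseˡ (occ i) q
              fp : fmAt p ≡ at f
              fp = ≡-trans (sym (occ-fm i p)) (≡-trans (cong fmAt to-p) fq)
              i' : Inst (plug P p Θ) (plug C q Θ)
              i' = subst (λ r → Inst (plug P p Θ) (plug C r Θ)) to-p (sc i p Θ)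

atomBoundFm : Fm → ℕ
atomBoundFm (at n) = n
atomBoundFm _      = 0

mutual
  atomBoundᵢ : Item → ℕ
  atomBoundᵢ (fm A) = atomBoundFm A
  atomBoundᵢ (wh Γ) = atomBound Γ
  atomBoundᵢ (bl Γ) = atomBound Γ

  atomBound : Seq → ℕ
  atomBound []      = 0
  atomBound (x ∷ Γ) = atomBoundᵢ x + atomBound Γ

isAt-above : ∀ b A → atomBoundFm A ≤ b → Atom.isAt (suc b) A ≡ false
isAt-above b (at n) h = above n b h
  where
    above : ∀ n b → n ≤ b → Atom.isAt (suc b) (at n) ≡ false
    above zero    b       _       = refl
    above (suc n) (suc b) (s≤s h) = above n b h
isAt-above b (nat _) h = refl
isAt-above b (_ ∨ _) h = refl
isAt-above b (_ ∧ _) h = refl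
isAt-above b (□ _)   h = refl
isAt-above b (■ _)   h = refl
isAt-above b (◇ _)   h = refl
isAt-above b (◆ _)   h = refl

mutual
  countᵢ-above : ∀ b x → atomBoundᵢ x ≤ b → Atom.countᵢ (suc b) x ≡ 0
  countᵢ-above b (fm A) h rewrite isAt-above b A h = refl
  countᵢ-above b (wh Γ) h = count-above b Γ h
  countᵢ-above b (bl Γ) h = count-above b Γ h

  count-above : ∀ b X → atomBound X ≤ b → Atom.count (suc b) X ≡ 0
  count-above b []      h = refl
  count-above b (x ∷ X) h = cong₂ _+_ (countᵢ-above b x (m+n≤o⇒m≤o (atomBoundᵢ x) h))
                                      (count-above b X (m+n≤o⇒n≤o (atomBoundᵢ x) h))

fresh-for : ∀ X → ∃ λ f → Atom.count f X ≡ 0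
fresh-for X = suc (atomBound X) , count-above _ X ≤-refl

module Marking (f : ℕ) (F : Fm) (f≢F : at f ≢ F) where

  -- Π⁻ is Π with one hole filled by F itself, and q is that occurrence of F.
  unmark : ∀ Π k → holes Π ≡ suc k →
           Σ Template λ Π⁻ → Σ (Pos (Π⁻ ⟨ at f ⟩)) λ q →
             holes Π⁻ ≡ k × Π⁻ ⟨ F ⟩ ≡ Π ⟨ F ⟩ × fmAt q ≡ F ×
             plug (Π⁻ ⟨ at f ⟩) q [ fm (at f) ] ≡ Π ⟨ at f ⟩
  unmark (hole ∷ M) k e = tfm F ∷ M , here , suc-injective e , refl , refl , refl
  unmark (tfm A ∷ M) k e with unmark M k e
  ... | M⁻ , q , e₁ , e₂ , e₃ , e₄ =
    tfm A ∷ M⁻ , there q , e₁ , cong (fm A ∷_) e₂ , e₃ , cong (fm A ∷_) e₄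
  unmark (twh N ∷ M) k e with holes N in eN
  ... | suc j with unmark N j eN
  ...   | N⁻ , q , e₁ , e₂ , e₃ , e₄ =
    twh N⁻ ∷ M , inWh q , ≡-trans (cong (_+ holes M) e₁) (suc-injective e) ,
    cong (λ Γ → wh Γ ∷ M ⟨ F ⟩) e₂ , e₃ , cong (λ Γ → wh Γ ∷ M ⟨ at f ⟩) e₄
  unmark (twh N ∷ M) k e | zero with unmark M k e
  ...   | M⁻ , q , e₁ , e₂ , e₃ , e₄ =
    twh N ∷ M⁻ , there q , ≡-trans (cong (_+ holes M⁻) eN) e₁ ,
    cong (wh (N ⟨ F ⟩) ∷_) e₂ , e₃ , cong (wh (N ⟨ at f ⟩) ∷_) e₄
  unmark (tbl N ∷ M) k e with holes N in eN
  ... | suc j with unmark N j eN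
  ...   | N⁻ , q , e₁ , e₂ , e₃ , e₄ =
    tbl N⁻ ∷ M , inBl q , ≡-trans (cong (_+ holes M) e₁) (suc-injective e) ,
    cong (λ Γ → bl Γ ∷ M ⟨ F ⟩) e₂ , e₃ , cong (λ Γ → bl Γ ∷ M ⟨ at f ⟩) e₄
  unmark (tbl N ∷ M) k e | zero with unmark M k e
  ...   | M⁻ , q , e₁ , e₂ , e₃ , e₄ =
    tbl N ∷ M⁻ , there q , ≡-trans (cong (_+ holes M⁻) eN) e₁ ,
    cong (bl (N ⟨ F ⟩) ∷_) e₂ , e₃ , cong (bl (N ⟨ at f ⟩) ∷_) e₄

  mark : ∀ M (p : Pos (M ⟨ at f ⟩)) → fmAt p ≡ F →
         ∃ λ M' → M' ⟨ at f ⟩ ≡ plug (M ⟨ at f ⟩) p [ fm (at f) ] × M' ⟨ F ⟩ ≡ M ⟨ F ⟩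
  mark (hole ∷ M) here e = ⊥-elim (f≢F e)
  mark (hole ∷ M) (there p) e with mark M p e
  ... | M' , e₁ , e₂ = hole ∷ M' , cong (fm (at f) ∷_) e₁ , cong (fm F ∷_) e₂
  mark (tfm A ∷ M) here refl = hole ∷ M , refl , refl
  mark (tfm A ∷ M) (there p) e with mark M p e
  ... | M' , e₁ , e₂ = tfm A ∷ M' , cong (fm A ∷_) e₁ , cong (fm A ∷_) e₂
  mark (twh N ∷ M) (there p) e with mark M p e
  ... | M' , e₁ , e₂ = twh N ∷ M' , cong (wh (N ⟨ at f ⟩) ∷_) e₁ , cong (wh (N ⟨ F ⟩) ∷_) e₂
  mark (twh N ∷ M) (inWh p) e with mark N p e
  ... | N' , e₁ , e₂ = twh N' ∷ M , cong (λ Γ → wh Γ ∷ M ⟨ at f ⟩) e₁ , cong (λ Γ → wh Γ ∷ M ⟨ F ⟩) e₂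
  mark (tbl N ∷ M) (there p) e with mark M p e
  ... | M' , e₁ , e₂ = tbl N ∷ M' , cong (bl (N ⟨ at f ⟩) ∷_) e₁ , cong (bl (N ⟨ F ⟩) ∷_) e₂
  mark (tbl N ∷ M) (inBl p) e with mark N p e
  ... | N' , e₁ , e₂ = tbl N' ∷ M , cong (λ Γ → bl Γ ∷ M ⟨ at f ⟩) e₁ , cong (λ Γ → bl Γ ∷ M ⟨ F ⟩) e₂

  module _ (R : LinearRule) (sc : SubstClosed R) where
    open LinearRule R

    Inst-mark₁ : ∀ ΠP {C} (i : Inst (ΠP ⟨ at f ⟩) C) (q : Pos C) → fmAt q ≡ F →
                 ∃ λ M → M ⟨ F ⟩ ≡ ΠP ⟨ F ⟩ × Inst (M ⟨ at f ⟩) (plug C q [ fm (at f) ])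
    Inst-mark₁ ΠP {C} i q fq =
      let M , m₁ , m₂ = mark ΠP p (≡-trans (sym (occ-fm i p)) (≡-trans (cong fmAt to-p) fq))
      in M , m₂ , subst₂ Inst (sym m₁) (cong (λ r → plug C r [ fm (at f) ]) to-p) (sc i p [ fm (at f) ])
      where
        p = Inverse.from (occ i) q
        to-p : Inverse.to (occ i) p ≡ q
        to-p = Inverse.strictlyInverseˡ (occ i) q

    Inst-mark : ∀ Π {P} → Inst P (Π ⟨ F ⟩) → ∃ λ ΠP → ΠP ⟨ F ⟩ ≡ P × Inst (ΠP ⟨ at f ⟩) (Π ⟨ at f ⟩)
    Inst-mark Π = go (holes Π) Π refl
      where
        go : ∀ k Π {P} → holes Π ≡ k → Inst P (Π ⟨ F ⟩) →
             ∃ λ ΠP → ΠP ⟨ F ⟩ ≡ P × Inst (ΠP ⟨ at f ⟩) (Π ⟨ at f ⟩)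
        go zero Π {P} e i =
          rigid P , rigid-⟦⟧ P _ , subst₂ Inst (sym (rigid-⟦⟧ P _)) (holes≡0⇒⟦⟧-const Π e _ _) i
        go (suc k) Π e i with unmark Π k e
        ... | Π⁻ , q , e₁ , e₂ , e₃ , e₄ with go k Π⁻ e₁ (subst (Inst _) (sym e₂) i)
        ...   | ΠP⁻ , eP , i⁻ with Inst-mark₁ ΠP⁻ i⁻ q e₃
        ...     | M , m₁ , m₂ = M , ≡-trans m₁ eP , subst (Inst _) e₄ m₂

Inst-⟦⟧ : (R : LinearRule) → SubstClosed R → ∀ F Θ Π {P} → LinearRule.Inst R P (Π ⟨ F ⟩) →
          ∃ λ ΠP → ΠP ⟨ F ⟩ ≡ P × LinearRule.Inst R (ΠP ⟦ Θ ⟧) (Π ⟦ Θ ⟧)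
Inst-⟦⟧ R sc F Θ Π {P} i with fresh-for (P ++ Π ⟨ F ⟩ ++ Θ ++ [ fm F ])
... | f , h with Atom.count-++⁻¹ f P _ h
... | P≡0 , h₁ with Atom.count-++⁻¹ f (Π ⟨ F ⟩) _ h₁
... | Π≡0 , h₂ with Atom.count-++⁻¹ f Θ _ h₂
... | Θ≡0 , F≡0 with Marking.Inst-mark f F (Atom.count≡0⇒≢ f F F≡0) R sc Π i
... | ΠP , refl , i' =
  ΠP , refl , subst₂ (LinearRule.Inst R)
                (Atom.replace-⟨at⟩ f Θ F ΠP P≡0) (Atom.replace-⟨at⟩ f Θ F Π Π≡0)
                (Atom.Inst-replace f Θ Θ≡0 R sc i')

module CutFree (S : RuleSet) (sc : ∀ i → SubstClosed (RuleSet.rule S i)) where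

  infix 2 ⊢_
  ⊢_ : Seq → Set
  ⊢ Γ = Der false S Γ

  ⊢-≡ : ∀ {Γ Δ} → Γ ≡ Δ → ⊢ Γ → ⊢ Δ
  ⊢-≡ = subst (Der false S)

  -- The premises of the rule concluding Ξ, A with A principal; a literal needs its dual in Ξ.
  Intro : Fm → Seq → Set
  Intro (at a)  Ξ = ∃ λ Ξ₀ → Ξ ≡ Ξ₀ ++ [ fm (nat a) ]
  Intro (nat a) Ξ = ∃ λ Ξ₀ → Ξ ≡ Ξ₀ ++ [ fm (at a) ]
  Intro (B ∧ C) Ξ = (⊢ Ξ ++ [ fm B ]) × (⊢ Ξ ++ [ fm C ])
  Intro (B ∨ C) Ξ = ⊢ Ξ ++ fm B ∷ [ fm C ]
  Intro (□ B)   Ξ = ⊢ Ξ ++ [ wh [ fm B ] ]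
  Intro (■ B)   Ξ = ⊢ Ξ ++ [ bl [ fm B ] ]
  Intro (◇ B)   Ξ = ∃₂ λ Ξ₀ W → Ξ ≡ Ξ₀ ++ [ wh W ] × (⊢ Ξ₀ ++ [ wh (W ++ [ fm B ]) ])
  Intro (◆ B)   Ξ = ∃₂ λ Ξ₀ W → Ξ ≡ Ξ₀ ++ [ bl W ] × (⊢ Ξ₀ ++ [ bl (W ++ [ fm B ]) ])

  intro : ∀ A Ξ → Intro A Ξ → ⊢ Ξ ++ [ fm A ]
  intro (at a)  _ (Ξ₀ , refl) = exch (≡⇒≈ (sym (++-assoc Ξ₀ _ _))) (exch (++⁺ˡ Ξ₀ swap) (id Ξ₀ a))
  intro (nat a) _ (Ξ₀ , refl) = ⊢-≡ (sym (++-assoc Ξ₀ _ _)) (id Ξ₀ a)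
  intro (B ∧ C) Ξ (d₁ , d₂) = and Ξ B C d₁ d₂
  intro (B ∨ C) Ξ d = or Ξ B C d
  intro (□ B)   Ξ d = boxF Ξ B d
  intro (■ B)   Ξ d = boxP Ξ B d
  intro (◇ B)   _ (Ξ₀ , W , refl , d) = ⊢-≡ (sym (++-assoc Ξ₀ _ _)) (diaF Ξ₀ W B d)
  intro (◆ B)   _ (Ξ₀ , W , refl , d) = ⊢-≡ (sym (++-assoc Ξ₀ _ _)) (diaP Ξ₀ W B d)

  Replaceable : Fm → Seq → Set
  Replaceable F Θ = ∀ Ξ → Intro F Ξ → ⊢ Ξ ++ Θ

  module _ {F : Fm} {Θ : Seq} (H : Replaceable F Θ) where

    replaceable : ∀ {A} → fm F ≡ fm A → Replaceable A Θ
    replaceable refl = H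

    principal : ∀ Π y {A} → y ⟨ F ⟩ᵢ ≡ fm A → Intro A (Π ⟦ Θ ⟧) → ⊢ (Π ++ y ∷ []) ⟦ Θ ⟧
    principal Π hole    e    p = ⊢-≡ (sym (⟦⟧-∷ʳ Π hole Θ)) (replaceable e _ p)
    principal Π (tfm A) refl p = ⊢-≡ (sym (⟦⟧-∷ʳ Π (tfm A) Θ)) (intro A _ p)

    principal-◆ : ∀ Π N y {B} → y ⟨ F ⟩ᵢ ≡ fm (◆ B) →
                  ⊢ Π ⟦ Θ ⟧ ++ [ bl ((N ++ tfm B ∷ []) ⟦ Θ ⟧) ] → ⊢ ((Π ++ tbl N ∷ []) ++ y ∷ []) ⟦ Θ ⟧
    principal-◆ Π N y {B} e d =
      principal (Π ++ tbl N ∷ []) y e (Π ⟦ Θ ⟧ , N ⟦ Θ ⟧ , ⟦⟧-∷ʳ Π (tbl N) Θ ,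
        ⊢-≡ (cong (λ W → Π ⟦ Θ ⟧ ++ [ bl W ]) (⟦⟧-∷ʳ N (tfm B) Θ)) d)

    principal-◇ : ∀ Π N y {B} → y ⟨ F ⟩ᵢ ≡ fm (◇ B) →
                  ⊢ Π ⟦ Θ ⟧ ++ [ wh ((N ++ tfm B ∷ []) ⟦ Θ ⟧) ] → ⊢ ((Π ++ twh N ∷ []) ++ y ∷ []) ⟦ Θ ⟧
    principal-◇ Π N y {B} e d =
      principal (Π ++ twh N ∷ []) y e (Π ⟦ Θ ⟧ , N ⟦ Θ ⟧ , ⟦⟧-∷ʳ Π (twh N) Θ ,
        ⊢-≡ (cong (λ W → Π ⟦ Θ ⟧ ++ [ wh W ]) (⟦⟧-∷ʳ N (tfm B) Θ)) d)

    axiom-⟦⟧ : ∀ {a} Π y₁ y₂ → y₁ ⟨ F ⟩ᵢ ≡ fm (at a) → y₂ ⟨ F ⟩ᵢ ≡ fm (nat a) →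
               ⊢ ((Π ++ y₁ ∷ []) ++ y₂ ∷ []) ⟦ Θ ⟧
    axiom-⟦⟧ Π hole hole e e' with ≡-trans (sym e) e'
    ... | ()
    axiom-⟦⟧ Π hole (tfm _) e refl =
      ⊢-≡ (sym (≡-trans (⟦⟧-∷ʳ (Π ++ hole ∷ []) _ Θ) (cong (_++ _) (⟦⟧-∷ʳ Π hole Θ))))
        (exch (trans (++-assoc-≈ (Π ⟦ Θ ⟧) _ Θ)
                (trans (++⁺ˡ (Π ⟦ Θ ⟧) (++-comm [ _ ] Θ)) (≈-sym (++-assoc-≈ (Π ⟦ Θ ⟧) Θ _))))
          (replaceable e _ (Π ⟦ Θ ⟧ , refl)))
    axiom-⟦⟧ Π (tfm _) y₂ refl e' = principal (Π ++ tfm _ ∷ []) y₂ e' (Π ⟦ Θ ⟧ , ⟦⟧-∷ʳ Π _ Θ)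

    mutual
      ⊢-⟦⟧ : ∀ {X} → ⊢ X → ∀ Π → Π ⟨ F ⟩ ≡ X → ⊢ Π ⟦ Θ ⟧
      ⊢-⟦⟧ (id Γ a) Π eq with ⟨⟩-∷ʳ⁻¹ (Γ ++ [ fm (at a) ]) Π (≡-trans eq (sym (++-assoc Γ _ _)))
      ... | Π₁ , y₂ , refl , e₁ , e₂ with ⟨⟩-∷ʳ⁻¹ Γ Π₁ e₁
      ... | Π₀ , y₁ , refl , refl , e₃ = axiom-⟦⟧ Π₀ y₁ y₂ e₃ e₂
      ⊢-⟦⟧ (cut () _ _ _ _ _) Π eq
      ⊢-⟦⟧ (and Γ B C d₁ d₂) Π eq with ⟨⟩-∷ʳ⁻¹ Γ Π eq
      ... | Π₁ , y , refl , refl , e =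
        principal Π₁ y e (⊢-⟦⟧-++ d₁ Π₁ (tfm B ∷ []) refl , ⊢-⟦⟧-++ d₂ Π₁ (tfm C ∷ []) refl)
      ⊢-⟦⟧ (or Γ B C d) Π eq with ⟨⟩-∷ʳ⁻¹ Γ Π eq
      ... | Π₁ , y , refl , refl , e = principal Π₁ y e (⊢-⟦⟧-++ d Π₁ (tfm B ∷ tfm C ∷ []) refl)
      ⊢-⟦⟧ (boxP Γ B d) Π eq with ⟨⟩-∷ʳ⁻¹ Γ Π eq
      ... | Π₁ , y , refl , refl , e = principal Π₁ y e (⊢-⟦⟧-++ d Π₁ (tbl (tfm B ∷ []) ∷ []) refl)
      ⊢-⟦⟧ (boxF Γ B d) Π eq with ⟨⟩-∷ʳ⁻¹ Γ Π eq
      ... | Π₁ , y , refl , refl , e = principal Π₁ y e (⊢-⟦⟧-++ d Π₁ (twh (tfm B ∷ []) ∷ []) refl)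
      ⊢-⟦⟧ (diaP Γ Δ B d) Π eq with ⟨⟩-∷ʳ⁻¹ (Γ ++ [ bl Δ ]) Π (≡-trans eq (sym (++-assoc Γ _ _)))
      ... | Π₁ , y , refl , e₁ , e with ⟨⟩-∷ʳ⁻¹ Γ Π₁ e₁
      ... | Π₀ , tbl N , refl , refl , refl =
        principal-◆ Π₀ N y e (⊢-⟦⟧-++ d Π₀ (tbl (N ++ tfm B ∷ []) ∷ [])
                               (cong (λ W → Π₀ ⟨ F ⟩ ++ [ bl W ]) (⟦⟧-∷ʳ N (tfm B) _)))
      ⊢-⟦⟧ (diaF Γ Δ B d) Π eq with ⟨⟩-∷ʳ⁻¹ (Γ ++ [ wh Δ ]) Π (≡-trans eq (sym (++-assoc Γ _ _)))
      ... | Π₁ , y , refl , e₁ , e with ⟨⟩-∷ʳ⁻¹ Γ Π₁ e₁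
      ... | Π₀ , twh N , refl , refl , refl =
        principal-◇ Π₀ N y e (⊢-⟦⟧-++ d Π₀ (twh (N ++ tfm B ∷ []) ∷ [])
                               (cong (λ W → Π₀ ⟨ F ⟩ ++ [ wh W ]) (⟦⟧-∷ʳ N (tfm B) _)))
      ⊢-⟦⟧ (ctr Γ Δ d) Π eq with ⟨⟩-++⁻¹ Γ Π eq
      ... | Π₁ , Π₂ , refl , refl , refl =
        ⊢-≡ (sym (⟦⟧-++ Π₁ Π₂ Θ)) (ctr (Π₁ ⟦ Θ ⟧) (Π₂ ⟦ Θ ⟧)
          (⊢-≡ (cong (Π₁ ⟦ Θ ⟧ ++_) (⟦⟧-++ Π₂ Π₂ Θ))
            (⊢-⟦⟧-++ d Π₁ (Π₂ ++ Π₂) (cong (Π₁ ⟨ F ⟩ ++_) (⟦⟧-++ Π₂ Π₂ _)))))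
      ⊢-⟦⟧ (wk Γ Δ d) Π eq with ⟨⟩-++⁻¹ Γ Π eq
      ... | Π₁ , Π₂ , refl , refl , refl =
        ⊢-≡ (sym (⟦⟧-++ Π₁ Π₂ Θ)) (wk (Π₁ ⟦ Θ ⟧) (Π₂ ⟦ Θ ⟧) (⊢-⟦⟧ d Π₁ refl))
      ⊢-⟦⟧ (rf Γ Δ d) Π eq with ⟨⟩-∷⁻¹ Π eq
      ... | tbl N , M , refl , refl , refl = rf _ _ (⊢-⟦⟧-++ d N (twh M ∷ []) refl)
      ⊢-⟦⟧ (rp Γ Δ d) Π eq with ⟨⟩-∷⁻¹ Π eq
      ... | twh N , M , refl , refl , refl = rp _ _ (⊢-⟦⟧-++ d N (tbl M ∷ []) refl)
      ⊢-⟦⟧ (exch p d) Π eq with ≈-lift Θ (≈-sym p) Π eq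
      ... | Π' , e' , q = exch (≈-sym q) (⊢-⟦⟧ d Π' e')
      ⊢-⟦⟧ (str i inst d) Π refl with Inst-⟦⟧ (RuleSet.rule S i) (sc i) F Θ Π inst
      ... | ΠP , refl , inst' = str i inst' (⊢-⟦⟧ d ΠP refl)

      ⊢-⟦⟧-++ : ∀ {X} → ⊢ X → ∀ Π T → Π ⟨ F ⟩ ++ T ⟨ F ⟩ ≡ X → ⊢ Π ⟦ Θ ⟧ ++ T ⟦ Θ ⟧
      ⊢-⟦⟧-++ d Π T e = ⊢-≡ (⟦⟧-++ Π T Θ) (⊢-⟦⟧ d (Π ++ T) (≡-trans (⟦⟧-++ Π T _) e))

  ⊢-replace : ∀ {F Θ} → Replaceable F Θ → ∀ Δ → ⊢ Δ ++ [ fm F ] → ⊢ Θ ++ Δ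
  ⊢-replace {F} {Θ} H Δ d =
    exch (++-comm Δ Θ) (⊢-≡ (fill Θ) (⊢-⟦⟧ H d (rigid Δ ++ hole ∷ []) (fill [ fm F ])))
    where
      fill : ∀ Θ' → (rigid Δ ++ hole ∷ []) ⟦ Θ' ⟧ ≡ Δ ++ Θ'
      fill Θ' = ≡-trans (⟦⟧-∷ʳ (rigid Δ) hole Θ') (cong (_++ Θ') (rigid-⟦⟧ Δ Θ'))

  CutAdmissible : Fm → Set
  CutAdmissible A = ∀ Γ Δ → ⊢ Γ ++ [ fm A ] → ⊢ Δ ++ [ fm (neg A) ] → ⊢ Γ ++ Δ

  literal-replaceable : ∀ x Γ Ξ → ⊢ Γ ++ [ x ] → ⊢ (Ξ ++ [ x ]) ++ Γ
  literal-replaceable x Γ Ξ d =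
    exch (trans (++-comm (Γ ++ [ x ]) Ξ)
            (trans (++⁺ˡ Ξ (++-comm Γ [ x ])) (≈-sym (++-assoc-≈ Ξ [ x ] Γ))))
      (wk (Γ ++ [ x ]) Ξ d)

  ∧-replaceable : ∀ {A₁ A₂ Ξ} → CutAdmissible A₁ → CutAdmissible A₂ →
                  ⊢ Ξ ++ fm (neg A₁) ∷ [ fm (neg A₂) ] → Replaceable (A₁ ∧ A₂) Ξ
  ∧-replaceable {A₁} {A₂} {Ξ} cut₁ cut₂ dĀ Ξ₂ (d₁ , d₂) =
    exch (++-comm Ξ Ξ₂) (ctr Ξ Ξ₂ (exch (trans (≈-sym (++-assoc-≈ Ξ₂ Ξ₂ Ξ)) (++-comm (Ξ₂ ++ Ξ₂) Ξ))
      (cut₂ Ξ₂ (Ξ₂ ++ Ξ) d₂ (⊢-≡ (sym (++-assoc Ξ₂ Ξ _))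
        (cut₁ Ξ₂ (Ξ ++ [ fm (neg A₂) ]) d₁
          (exch (trans (++⁺ˡ Ξ swap) (≈-sym (++-assoc-≈ Ξ _ _))) dĀ))))))

  ∨-replaceable : ∀ {A₁ A₂ Ξ} → CutAdmissible A₁ → CutAdmissible A₂ →
                  ⊢ Ξ ++ [ fm (neg A₁) ] → ⊢ Ξ ++ [ fm (neg A₂) ] → Replaceable (A₁ ∨ A₂) Ξ
  ∨-replaceable {A₁} {A₂} {Ξ} cut₁ cut₂ dĀ₁ dĀ₂ Ξ₂ d =
    ctr Ξ₂ Ξ (⊢-≡ (++-assoc Ξ₂ Ξ Ξ)
      (cut₂ (Ξ₂ ++ Ξ) Ξ
        (exch (trans (++-assoc-≈ Ξ₂ _ Ξ)
                (trans (++⁺ˡ Ξ₂ (++-comm [ fm A₂ ] Ξ)) (≈-sym (++-assoc-≈ Ξ₂ Ξ _))))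
          (cut₁ (Ξ₂ ++ [ fm A₂ ]) Ξ (exch (trans (++⁺ˡ Ξ₂ swap) (≈-sym (++-assoc-≈ Ξ₂ _ _))) d) dĀ₁))
        dĀ₂))

  □-replaceable : ∀ {A} → CutAdmissible A → ∀ Ξ₀ W →
                  ⊢ Ξ₀ ++ [ wh (W ++ [ fm (neg A) ]) ] → Replaceable (□ A) (Ξ₀ ++ [ wh W ])
  □-replaceable {A} cutA Ξ₀ W dĀ Ξ₂ d =
    exch (trans (++-comm [ wh W ] (Ξ₂ ++ Ξ₀)) (++-assoc-≈ Ξ₂ Ξ₀ _))
      (rp W (Ξ₂ ++ Ξ₀) (exch (++-comm [ bl (Ξ₂ ++ Ξ₀) ] W)
        (bl-merge Ξ₂ Ξ₀ W (cutA [ bl Ξ₂ ] (bl Ξ₀ ∷ W) (rf Ξ₂ [ fm A ] d) (rf Ξ₀ _ dĀ)))))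

  ■-replaceable : ∀ {A} → CutAdmissible A → ∀ Ξ₀ W →
                  ⊢ Ξ₀ ++ [ bl (W ++ [ fm (neg A) ]) ] → Replaceable (■ A) (Ξ₀ ++ [ bl W ])
  ■-replaceable {A} cutA Ξ₀ W dĀ Ξ₂ d =
    exch (trans (++-comm [ bl W ] (Ξ₂ ++ Ξ₀)) (++-assoc-≈ Ξ₂ Ξ₀ _))
      (rf W (Ξ₂ ++ Ξ₀) (exch (++-comm [ wh (Ξ₂ ++ Ξ₀) ] W)
        (wh-merge Ξ₂ Ξ₀ W (cutA [ wh Ξ₂ ] (wh Ξ₀ ∷ W) (rp Ξ₂ [ fm A ] d) (rp Ξ₀ _ dĀ)))))

  ◇-replaceable : ∀ {A Ξ} → CutAdmissible A → ⊢ Ξ ++ [ wh [ fm (neg A) ] ] → Replaceable (◇ A) Ξ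
  ◇-replaceable {Ξ = Ξ} cutA dĀ _ (Ξ₀ , W , refl , d) =
    exch (trans (shift (wh W) Ξ₀ Ξ) (≈-sym (++-assoc-≈ Ξ₀ [ wh W ] Ξ)))
      (rp W (Ξ₀ ++ Ξ) (exch (++-comm [ bl (Ξ₀ ++ Ξ) ] W)
        (bl-merge Ξ₀ Ξ W (exch (≈ᵢ-refl _ ∷ ++-comm W [ bl Ξ ])
          (cutA (bl Ξ₀ ∷ W) [ bl Ξ ] (rf Ξ₀ _ d) (rf Ξ _ dĀ))))))

  ◆-replaceable : ∀ {A Ξ} → CutAdmissible A → ⊢ Ξ ++ [ bl [ fm (neg A) ] ] → Replaceable (◆ A) Ξ
  ◆-replaceable {Ξ = Ξ} cutA dĀ _ (Ξ₀ , W , refl , d) =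
    exch (trans (shift (bl W) Ξ₀ Ξ) (≈-sym (++-assoc-≈ Ξ₀ [ bl W ] Ξ)))
      (rf W (Ξ₀ ++ Ξ) (exch (++-comm [ wh (Ξ₀ ++ Ξ) ] W)
        (wh-merge Ξ₀ Ξ W (exch (≈ᵢ-refl _ ∷ ++-comm W [ wh Ξ ])
          (cutA (wh Ξ₀ ∷ W) [ wh Ξ ] (rp Ξ₀ _ d) (rp Ξ _ dĀ))))))

  mutual
    cut-admissible : ∀ A → CutAdmissible A
    cut-admissible A Γ Δ dA = ⊢-replace (dual-replaceable A Γ dA) Δ

    dual-replaceable : ∀ A Γ → ⊢ Γ ++ [ fm A ] → Replaceable (neg A) Γ
    dual-replaceable (at a)    Γ dA _ (Ξ₀ , refl) = literal-replaceable (fm (at a)) Γ Ξ₀ dA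
    dual-replaceable (nat a)   Γ dA _ (Ξ₀ , refl) = literal-replaceable (fm (nat a)) Γ Ξ₀ dA
    dual-replaceable (A₁ ∧ A₂) Γ dA _ dĀ =
      ⊢-replace (∧-replaceable (cut-admissible A₁) (cut-admissible A₂) dĀ) Γ dA
    dual-replaceable (A₁ ∨ A₂) Γ dA _ (dĀ₁ , dĀ₂) =
      ⊢-replace (∨-replaceable (cut-admissible A₁) (cut-admissible A₂) dĀ₁ dĀ₂) Γ dA
    dual-replaceable (□ A) Γ dA _ (Ξ₀ , W , refl , dĀ) =
      ⊢-replace (□-replaceable (cut-admissible A) Ξ₀ W dĀ) Γ dA
    dual-replaceable (■ A) Γ dA _ (Ξ₀ , W , refl , dĀ) =
      ⊢-replace (■-replaceable (cut-admissible A) Ξ₀ W dĀ) Γ dA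
    dual-replaceable (◇ A) Γ dA _ dĀ = ⊢-replace (◇-replaceable (cut-admissible A) dĀ) Γ dA
    dual-replaceable (◆ A) Γ dA _ dĀ = ⊢-replace (◆-replaceable (cut-admissible A) dĀ) Γ dA

  cut-elimination : ∀ {Γ} → Der true S Γ → ⊢ Γ
  cut-elimination (id Γ a)              = id Γ a
  cut-elimination (cut _ Γ Δ A d₁ d₂)   = cut-admissible A Γ Δ (cut-elimination d₁) (cut-elimination d₂)
  cut-elimination (and Γ A B d₁ d₂)     = and Γ A B (cut-elimination d₁) (cut-elimination d₂)
  cut-elimination (or Γ A B d)          = or Γ A B (cut-elimination d)
  cut-elimination (ctr Γ Δ d)           = ctr Γ Δ (cut-elimination d)
  cut-elimination (wk Γ Δ d)            = wk Γ Δ (cut-elimination d)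
  cut-elimination (rf Γ Δ d)            = rf Γ Δ (cut-elimination d)
  cut-elimination (rp Γ Δ d)            = rp Γ Δ (cut-elimination d)
  cut-elimination (boxP Γ A d)          = boxP Γ A (cut-elimination d)
  cut-elimination (boxF Γ A d)          = boxF Γ A (cut-elimination d)
  cut-elimination (diaP Γ Δ A d)        = diaP Γ Δ A (cut-elimination d)
  cut-elimination (diaF Γ Δ A d)        = diaF Γ Δ A (cut-elimination d)
  cut-elimination (exch p d)            = exch p (cut-elimination d)
  cut-elimination (str i inst d)        = str i inst (cut-elimination d)

theorem3p16 : (S : RuleSet) →
    (∀ i → SubstClosed (RuleSet.rule S i)) →
    CutElimination S
theorem3p16 S sc _ = CutFree.cut-elimination S sc
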